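{- Let $n\ge 2$. Then \[ \sum_{k=1}^{n}[k]_q\,q^{k-1}\,\frac{[k]_q\,[k-1]_q}{1+q}\;=\;\sum_{(a,b,c,d)\in A,\ a<b} q^{(a-1)+(b-2)+(c-1)+(d-1)}, \] where the sum on the right runs over the location labels $(a,b,c,d)$ of the unit cubes of block $A$ with $a<b$. The exponent of $q$ on the right side is the taxicab ($\ell^1$) distance between the label $(a,b,c,d)$ and $(1,2,1,1)$.
   Context: $[k]_q=1+q+\cdots+q^{k-1}$ for non-negative integers $k$ (so $[0]_q=0$). For fixed $n\ge 2$, block $A$ is the union of the unit cubes $\{(x,y,z,w): a-1\le x\le a,\ b-1\le y\le b,\ c-1\le z\le c,\ d-1\le w\le d\}$ whose location labels $(a,b,c,d)$ lie in $\{(x,y,z,w)\in\mathbb{Z}^4: 1\le i\le n,\ z=i,\ x,y,w\in\{1,\dots,i\}\}$. -}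

module Defs where

open import Data.Nat using (ℕ; zero; suc; _+_; _*_; _∸_; _^_; _<?_)
open import Data.Nat.DivMod using (_/_)
open import Data.List using (List; []; _∷_; map; upTo; concatMap; filter)
open import Data.Nat.ListAction using (sum)
open import Data.Product using (_×_; _,_; proj₁; proj₂)

oneTo : ℕ → List ℕ
oneTo n = map suc (upTo n)

qint : ℕ → ℕ → ℕ
qint q k = sum (map (λ j → q ^ j) (upTo k))

Label : Set
Label = ℕ × ℕ × ℕ × ℕ

-- the labels of block A:  1 ≤ i ≤ n, c = i, a,b,d ∈ {1..i}
blockA : ℕ → List Label
blockA n = concatMap (λ i →
             concatMap (λ x →
               concatMap (λ y →
                 map (λ w → (x , y , i , w)) (oneTo i))
               (oneTo i))
             (oneTo i))
           (oneTo n)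

blockA< : ℕ → List Label
blockA< n = filter (λ l → proj₁ l <? proj₁ (proj₂ l)) (blockA n)

expo : Label → ℕ
expo (a , b , c , d) = (a ∸ 1) + (b ∸ 2) + (c ∸ 1) + (d ∸ 1)

-- left side, evaluated at q; the quotient by 1+q is exact division in ℕ
lhs : ℕ → ℕ → ℕ
lhs q n = sum (map (λ k → qint q k * q ^ (k ∸ 1) * ((qint q k * qint q (k ∸ 1)) / suc q)) (oneTo n))

rhs : ℕ → ℕ → ℕ
rhs q n = sum (map (λ l → q ^ expo l) (blockA< n))

-- For the slice c = i of block A the sum over d contributes q^(i-1) [i]_q, and
-- the sum over a < b in {1..i} is the Gaussian binomial [i choose 2]_q.
-- Adding the row and column i+1 to the pairs gives the recursion
-- [i+1 choose 2]_q = [i choose 2]_q + q^(i-1) [i]_q, from which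
-- (1+q) [i choose 2]_q = [i]_q [i-1]_q follows by induction; so the division
-- by 1+q on the left is exact and both sides agree summand by summand.
module Submission where

open import Defs
open import Data.Bool using (true; false; if_then_else_)
open import Data.List using (List; []; _∷_; _++_; [_]; map; upTo; concatMap; filter)
open import Data.List.Properties using (map-++; map-∘; upTo-∷ʳ)
open import Data.Nat using (ℕ; zero; suc; _+_; _*_; _∸_; _^_; _≤_; _<_; _<?_; s≤s)
open import Data.Nat.DivMod using (_/_; m*n/n≡m)
open import Data.Nat.ListAction using (sum)
open import Data.Nat.ListAction.Properties using (sum-++)
open import Data.Nat.Properties
open import Algebra.Properties.CommutativeSemigroup +-commutativeSemigroup
  using () renaming (interchange to +-interchange)
open import Data.Nat.Solver using (module +-*-Solver)
open import Data.Product using (_,_; proj₁; proj₂)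
open import Function using (_∘_)
open import Relation.Binary.PropositionalEquality
  using (_≡_; refl; sym; trans; cong; cong₂; module ≡-Reasoning)
open import Relation.Nullary using (does; ¬_)
open import Relation.Nullary.Decidable using (dec-true; dec-false)
open import Relation.Unary using (Pred; Decidable)

open ≡-Reasoning

∑ : ℕ → (ℕ → ℕ) → ℕ
∑ zero    f = 0
∑ (suc n) f = ∑ n f + f (suc n)

∑-cong : ∀ {f g : ℕ → ℕ} n → (∀ {j} → j ≤ n → f j ≡ g j) → ∑ n f ≡ ∑ n g
∑-cong zero    f≗g = refl
∑-cong (suc n) f≗g = cong₂ _+_ (∑-cong n (f≗g ∘ m≤n⇒m≤1+n)) (f≗g ≤-refl)

∑-zero : ∀ n → ∑ n (λ _ → 0) ≡ 0
∑-zero zero    = refl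
∑-zero (suc n) = trans (+-identityʳ _) (∑-zero n)

∑-distrib-+ : ∀ (f g : ℕ → ℕ) n → ∑ n (λ j → f j + g j) ≡ ∑ n f + ∑ n g
∑-distrib-+ f g zero    = refl
∑-distrib-+ f g (suc n) = begin
  ∑ n (λ j → f j + g j) + (f (suc n) + g (suc n))
    ≡⟨ cong (_+ (f (suc n) + g (suc n))) (∑-distrib-+ f g n) ⟩
  ∑ n f + ∑ n g + (f (suc n) + g (suc n))
    ≡⟨ +-interchange (∑ n f) (∑ n g) (f (suc n)) (g (suc n)) ⟩
  ∑ n f + f (suc n) + (∑ n g + g (suc n)) ∎

∑-*ˡ : ∀ c (f : ℕ → ℕ) n → ∑ n (λ j → c * f j) ≡ c * ∑ n f
∑-*ˡ c f zero    = sym (*-zeroʳ c)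
∑-*ˡ c f (suc n) = trans (cong (_+ c * f (suc n)) (∑-*ˡ c f n)) (sym (*-distribˡ-+ c _ _))

∑-*ʳ : ∀ c (f : ℕ → ℕ) n → ∑ n (λ j → f j * c) ≡ ∑ n f * c
∑-*ʳ c f zero    = refl
∑-*ʳ c f (suc n) = trans (cong (_+ f (suc n) * c) (∑-*ʳ c f n)) (sym (*-distribʳ-+ c (∑ n f) (f (suc n))))

oneTo-suc : ∀ n → oneTo (suc n) ≡ oneTo n ++ [ suc n ]
oneTo-suc n = trans (cong (map suc) (sym (upTo-∷ʳ n))) (map-++ suc (upTo n) [ n ])

sum-map-oneTo : ∀ (f : ℕ → ℕ) n → sum (map f (oneTo n)) ≡ ∑ n f
sum-map-oneTo f zero    = refl
sum-map-oneTo f (suc n) = begin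
  sum (map f (oneTo (suc n)))            ≡⟨ cong (sum ∘ map f) (oneTo-suc n) ⟩
  sum (map f (oneTo n ++ [ suc n ]))     ≡⟨ cong sum (map-++ f (oneTo n) [ suc n ]) ⟩
  sum (map f (oneTo n) ++ [ f (suc n) ]) ≡⟨ sum-++ (map f (oneTo n)) [ f (suc n) ] ⟩
  sum (map f (oneTo n)) + (f (suc n) + 0) ≡⟨ cong₂ _+_ (sum-map-oneTo f n) (+-identityʳ _) ⟩
  ∑ n f + f (suc n)                      ∎

sum-map-concatMap : ∀ {a b} {A : Set a} {B : Set b} (f : B → ℕ) (g : A → List B) xs →
                    sum (map f (concatMap g xs)) ≡ sum (map (sum ∘ map f ∘ g) xs)
sum-map-concatMap f g []       = refl
sum-map-concatMap f g (x ∷ xs) = begin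
  sum (map f (g x ++ concatMap g xs))
    ≡⟨ cong sum (map-++ f (g x) (concatMap g xs)) ⟩
  sum (map f (g x) ++ map f (concatMap g xs))
    ≡⟨ sum-++ (map f (g x)) (map f (concatMap g xs)) ⟩
  sum (map f (g x)) + sum (map f (concatMap g xs))
    ≡⟨ cong (sum (map f (g x)) +_) (sum-map-concatMap f g xs) ⟩
  sum (map f (g x)) + sum (map (sum ∘ map f ∘ g) xs) ∎

sum-map-filter : ∀ {a p} {A : Set a} {P : Pred A p} (P? : Decidable P) (f : A → ℕ) xs →
                 sum (map f (filter P? xs)) ≡ sum (map (λ x → if does (P? x) then f x else 0) xs)
sum-map-filter P? f []       = refl
sum-map-filter P? f (x ∷ xs) with does (P? x)
... | true  = cong (f x +_) (sum-map-filter P? f xs)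
... | false = sum-map-filter P? f xs

sum-map-blockA : ∀ (h : Label → ℕ) n → sum (map h (blockA n)) ≡
                 ∑ n λ i → ∑ i λ x → ∑ i λ y → ∑ i λ w → h (x , y , i , w)
sum-map-blockA h n =
  trans (sum-over-oneTo _ n) (∑-cong n λ {i} _ →
  trans (sum-over-oneTo _ i) (∑-cong i λ {x} _ →
  trans (sum-over-oneTo _ i) (∑-cong i λ {y} _ →
  trans (cong sum (sym (map-∘ (oneTo i)))) (sum-map-oneTo _ i))))
  where
  sum-over-oneTo : ∀ (g : ℕ → List Label) m →
                   sum (map h (concatMap g (oneTo m))) ≡ ∑ m (sum ∘ map h ∘ g)
  sum-over-oneTo g m = trans (sum-map-concatMap h g (oneTo m)) (sum-map-oneTo _ m)

qint-∑ : ∀ q k → qint q k ≡ ∑ k (λ j → q ^ (j ∸ 1))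
qint-∑ q k = trans (cong sum (map-∘ (upTo k))) (sum-map-oneTo _ k)

qint-suc : ∀ q k → qint q (suc k) ≡ qint q k + q ^ k
qint-suc q k = trans (qint-∑ q (suc k)) (cong (_+ q ^ k) (sym (qint-∑ q k)))

if-*ʳ : ∀ b m n → (if b then m * n else 0) ≡ (if b then m else 0) * n
if-*ʳ true  m n = refl
if-*ʳ false m n = refl

pairWeight : ℕ → ℕ → ℕ → ℕ
pairWeight q x y = if does (x <? y) then q ^ ((x ∸ 1) + (y ∸ 2)) else 0

pairWeight-< : ∀ q {x y} → x < y → pairWeight q x y ≡ q ^ ((x ∸ 1) + (y ∸ 2))
pairWeight-< q {x} {y} x<y rewrite dec-true (x <? y) x<y = refl

pairWeight-≮ : ∀ q {x y} → ¬ x < y → pairWeight q x y ≡ 0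
pairWeight-≮ q {x} {y} x≮y rewrite dec-false (x <? y) x≮y = refl

qBinom₂ : ℕ → ℕ → ℕ
qBinom₂ q i = ∑ i λ x → ∑ i λ y → pairWeight q x y

qBinom₂-suc : ∀ q m → qBinom₂ q (suc m) ≡ qBinom₂ q m + q ^ (m ∸ 1) * qint q m
qBinom₂-suc q m = begin
  ∑ (suc m) (λ x → ∑ m (pairWeight q x) + pairWeight q x (suc m))
    ≡⟨ ∑-distrib-+ (λ x → ∑ m (pairWeight q x)) (λ x → pairWeight q x (suc m)) (suc m) ⟩
  (qBinom₂ q m + ∑ m (pairWeight q (suc m)))
    + (∑ m (λ x → pairWeight q x (suc m)) + pairWeight q (suc m) (suc m))
    ≡⟨ cong₂ _+_ (cong (qBinom₂ q m +_) new-row)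
                 (cong₂ _+_ new-column (pairWeight-≮ q {suc m} (<-irrefl refl))) ⟩
  (qBinom₂ q m + 0) + (q ^ (m ∸ 1) * qint q m + 0)
    ≡⟨ cong₂ _+_ (+-identityʳ (qBinom₂ q m)) (+-identityʳ (q ^ (m ∸ 1) * qint q m)) ⟩
  qBinom₂ q m + q ^ (m ∸ 1) * qint q m ∎
  where
  new-row : ∑ m (pairWeight q (suc m)) ≡ 0
  new-row = trans (∑-cong m λ y≤m → pairWeight-≮ q (≤⇒≯ (m≤n⇒m≤1+n y≤m))) (∑-zero m)

  new-column : ∑ m (λ x → pairWeight q x (suc m)) ≡ q ^ (m ∸ 1) * qint q m
  new-column = begin
    ∑ m (λ x → pairWeight q x (suc m))
      ≡⟨ ∑-cong m (λ {x} x≤m → trans (pairWeight-< q (s≤s x≤m))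
           (trans (^-distribˡ-+-* q (x ∸ 1) (m ∸ 1)) (*-comm (q ^ (x ∸ 1)) (q ^ (m ∸ 1))))) ⟩
    ∑ m (λ x → q ^ (m ∸ 1) * q ^ (x ∸ 1))
      ≡⟨ ∑-*ˡ (q ^ (m ∸ 1)) (λ x → q ^ (x ∸ 1)) m ⟩
    q ^ (m ∸ 1) * ∑ m (λ x → q ^ (x ∸ 1))
      ≡⟨ cong (q ^ (m ∸ 1) *_) (qint-∑ q m) ⟨
    q ^ (m ∸ 1) * qint q m ∎

qBinom₂-formula : ∀ q k → qBinom₂ q k * suc q ≡ qint q k * qint q (k ∸ 1)
qBinom₂-formula q zero          = refl
qBinom₂-formula q (suc zero)    = refl
qBinom₂-formula q (suc (suc p)) = begin
  qBinom₂ q (2 + p) * suc q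
    ≡⟨ cong (_* suc q) (qBinom₂-suc q (suc p)) ⟩
  (qBinom₂ q (suc p) + q ^ p * [p+1]) * suc q
    ≡⟨ *-distribʳ-+ (suc q) (qBinom₂ q (suc p)) _ ⟩
  qBinom₂ q (suc p) * suc q + q ^ p * [p+1] * suc q
    ≡⟨ cong (_+ q ^ p * [p+1] * suc q) (qBinom₂-formula q (suc p)) ⟩
  [p+1] * qint q p + q ^ p * [p+1] * suc q
    ≡⟨ solve 4 (λ a b c x → a :* b :+ c :* a :* (con 1 :+ x) := a :* (b :+ c :+ x :* c))
             refl [p+1] (qint q p) (q ^ p) q ⟩
  [p+1] * (qint q p + q ^ p + q * q ^ p)
    ≡⟨ cong (λ z → [p+1] * (z + q ^ (suc p))) (qint-suc q p) ⟨
  [p+1] * ([p+1] + q ^ suc p)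
    ≡⟨ cong ([p+1] *_) (qint-suc q (suc p)) ⟨
  [p+1] * qint q (2 + p)
    ≡⟨ *-comm [p+1] _ ⟩
  qint q (2 + p) * [p+1] ∎
  where
  open +-*-Solver
  [p+1] = qint q (suc p)

blockA<-summand : ∀ q x y i w →
                  (if does (x <? y) then q ^ expo (x , y , i , w) else 0)
                  ≡ pairWeight q x y * q ^ (i ∸ 1) * q ^ (w ∸ 1)
blockA<-summand q x y i w = begin
  (if does (x <? y) then q ^ expo (x , y , i , w) else 0)
    ≡⟨ cong (λ e → if does (x <? y) then e else 0) split-power ⟩
  (if does (x <? y) then q ^ ((x ∸ 1) + (y ∸ 2)) * q ^ (i ∸ 1) * q ^ (w ∸ 1) else 0)
    ≡⟨ if-*ʳ (does (x <? y)) _ (q ^ (w ∸ 1)) ⟩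
  (if does (x <? y) then q ^ ((x ∸ 1) + (y ∸ 2)) * q ^ (i ∸ 1) else 0) * q ^ (w ∸ 1)
    ≡⟨ cong (_* q ^ (w ∸ 1)) (if-*ʳ (does (x <? y)) _ (q ^ (i ∸ 1))) ⟩
  pairWeight q x y * q ^ (i ∸ 1) * q ^ (w ∸ 1) ∎
  where
  split-power : q ^ expo (x , y , i , w) ≡ q ^ ((x ∸ 1) + (y ∸ 2)) * q ^ (i ∸ 1) * q ^ (w ∸ 1)
  split-power = trans (^-distribˡ-+-* q (x ∸ 1 + (y ∸ 2) + (i ∸ 1)) (w ∸ 1))
                      (cong (_* q ^ (w ∸ 1)) (^-distribˡ-+-* q (x ∸ 1 + (y ∸ 2)) (i ∸ 1)))

sum-slice : ∀ q i →
            (∑ i λ x → ∑ i λ y → ∑ i λ w → if does (x <? y) then q ^ expo (x , y , i , w) else 0)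
            ≡ qBinom₂ q i * (q ^ (i ∸ 1) * qint q i)
sum-slice q i = begin
  (∑ i λ x → ∑ i λ y → ∑ i λ w → if does (x <? y) then q ^ expo (x , y , i , w) else 0)
    ≡⟨ ∑-cong i (λ {x} _ → ∑-cong i (λ {y} _ →
         trans (∑-cong i (λ {w} _ → blockA<-summand q x y i w)) (sum-over-w x y))) ⟩
  (∑ i λ x → ∑ i λ y → pairWeight q x y * c)
    ≡⟨ ∑-cong i (λ {x} _ → ∑-*ʳ c (pairWeight q x) i) ⟩
  (∑ i λ x → ∑ i (pairWeight q x) * c)
    ≡⟨ ∑-*ʳ c (λ x → ∑ i (pairWeight q x)) i ⟩
  qBinom₂ q i * c ∎
  where
  c = q ^ (i ∸ 1) * qint q i

  sum-over-w : ∀ x y → ∑ i (λ w → pairWeight q x y * q ^ (i ∸ 1) * q ^ (w ∸ 1)) ≡ pairWeight q x y * c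
  sum-over-w x y = begin
    ∑ i (λ w → pairWeight q x y * q ^ (i ∸ 1) * q ^ (w ∸ 1))
      ≡⟨ ∑-*ˡ (pairWeight q x y * q ^ (i ∸ 1)) (λ w → q ^ (w ∸ 1)) i ⟩
    pairWeight q x y * q ^ (i ∸ 1) * ∑ i (λ w → q ^ (w ∸ 1))
      ≡⟨ cong (pairWeight q x y * q ^ (i ∸ 1) *_) (qint-∑ q i) ⟨
    pairWeight q x y * q ^ (i ∸ 1) * qint q i
      ≡⟨ *-assoc (pairWeight q x y) (q ^ (i ∸ 1)) (qint q i) ⟩
    pairWeight q x y * c ∎

rhs-as-∑ : ∀ q n → rhs q n ≡ ∑ n (λ i → qBinom₂ q i * (q ^ (i ∸ 1) * qint q i))
rhs-as-∑ q n = begin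
  rhs q n
    ≡⟨ sum-map-filter _ (λ l → q ^ expo l) (blockA n) ⟩
  sum (map (λ l → if does (proj₁ l <? proj₁ (proj₂ l)) then q ^ expo l else 0) (blockA n))
    ≡⟨ sum-map-blockA _ n ⟩
  (∑ n λ i → ∑ i λ x → ∑ i λ y → ∑ i λ w → if does (x <? y) then q ^ expo (x , y , i , w) else 0)
    ≡⟨ ∑-cong n (λ {i} _ → sum-slice q i) ⟩
  ∑ n (λ i → qBinom₂ q i * (q ^ (i ∸ 1) * qint q i)) ∎

lhs-summand : ∀ q k → qint q k * q ^ (k ∸ 1) * ((qint q k * qint q (k ∸ 1)) / suc q)
                      ≡ qBinom₂ q k * (q ^ (k ∸ 1) * qint q k)
lhs-summand q k = begin
  qint q k * q ^ (k ∸ 1) * ((qint q k * qint q (k ∸ 1)) / suc q)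
    ≡⟨ cong (λ z → qint q k * q ^ (k ∸ 1) * (z / suc q)) (qBinom₂-formula q k) ⟨
  qint q k * q ^ (k ∸ 1) * (qBinom₂ q k * suc q / suc q)
    ≡⟨ cong (qint q k * q ^ (k ∸ 1) *_) (m*n/n≡m (qBinom₂ q k) (suc q)) ⟩
  qint q k * q ^ (k ∸ 1) * qBinom₂ q k
    ≡⟨ *-comm (qint q k * q ^ (k ∸ 1)) (qBinom₂ q k) ⟩
  qBinom₂ q k * (qint q k * q ^ (k ∸ 1))
    ≡⟨ cong (qBinom₂ q k *_) (*-comm (qint q k) (q ^ (k ∸ 1))) ⟩
  qBinom₂ q k * (q ^ (k ∸ 1) * qint q k) ∎

-- The identity holds for every n.
lemma19 : (n : ℕ) → 2 ≤ n → (q : ℕ) → lhs q n ≡ rhs q n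
lemma19 n _ q = begin
  lhs q n
    ≡⟨ sum-map-oneTo _ n ⟩
  ∑ n (λ k → qint q k * q ^ (k ∸ 1) * ((qint q k * qint q (k ∸ 1)) / suc q))
    ≡⟨ ∑-cong n (λ {k} _ → lhs-summand q k) ⟩
  ∑ n (λ k → qBinom₂ q k * (q ^ (k ∸ 1) * qint q k))
    ≡⟨ rhs-as-∑ q n ⟨
  rhs q n ∎
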